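{- Let $m>2$ be an integer, $q=2^m$, let $k$ be a positive integer, let $s=\gcd(k,m)$, and let $a\in\mathbb{F}_q^*$. Let $N(a)$ be the number of solutions $x\in\mathbb{F}_q$ of $$x^{2^k}+x^{2^k-1}=a.$$ Then $$N(a)=\begin{cases}1 & \text{if } a\neq b^{2^k-1} \text{ for all } b\in\mathbb{F}_q,\\ 2^s & \text{if } a=b^{2^k-1} \text{ for some } b\in\mathbb{F}_q \text{ and } \mathrm{Tr}_s(b)=0,\\ 0 & \text{if } a=b^{2^k-1} \text{ for some } b\in\mathbb{F}_q \text{ and } \mathrm{Tr}_s(b)\neq 0.\end{cases}$$
   Context: $\mathbb{F}_q$ is the finite field with $q=2^m$ elements and $\mathbb{F}_q^*=\mathbb{F}_q\setminus\{0\}$. For a positive divisor $s$ of $m$, $\mathrm{Tr}_s:\mathbb{F}_q\to\mathbb{F}_{2^s}$ is the relative trace $\mathrm{Tr}_s(x)=x+x^{2^s}+x^{2^{2s}}+\dots+x^{2^{(m/s-1)s}}$. -}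

module Defs where

open import Level using (0ℓ)
open import Algebra.Bundles using (CommutativeRing)
open import Data.Nat using (ℕ; zero; suc; _^_; NonZero; ≢-nonZero)
import Data.Nat as ℕ
open import Data.Nat.DivMod using (_/_)
open import Data.Nat.GCD using (gcd; gcd[m,n]≢0)
open import Data.Fin using (Fin)
open import Data.List using (List; length; filter)
open import Data.List.Base using (allFin)
open import Data.Product using (∃; _×_)
open import Data.Sum using (inj₁)
open import Relation.Nullary using (¬_)
open import Relation.Unary using (Decidable)
open import Relation.Binary.PropositionalEquality using (_≡_)
import Relation.Binary.Definitions as B

-- A finite field with exactly 2^m elements (hence of characteristic 2).
-- Up to isomorphism this is the field F_q, q = 2^m.
-- Equality is the (decidable) setoid equality of the ring.
record FiniteField (m : ℕ) : Set₁ where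
  field
    commRing : CommutativeRing 0ℓ 0ℓ
  open CommutativeRing commRing public
  field
    _≟_        : B.Decidable _≈_
    1≉0        : ¬ (1# ≈ 0#)
    inverse    : ∀ x → ¬ (x ≈ 0#) → ∃ λ y → x * y ≈ 1#
    enum       : Fin (2 ^ m) → Carrier
    enum-surj  : ∀ x → ∃ λ i → enum i ≈ x
    enum-inj   : ∀ i j → enum i ≈ enum j → i ≡ j

module _ {m : ℕ} (F : FiniteField m) where
  open FiniteField F

  pow : Carrier → ℕ → Carrier
  pow x zero    = 1#
  pow x (suc n) = x * pow x n

  sumF : (ℕ → Carrier) → ℕ → Carrier
  sumF f zero    = 0#
  sumF f (suc t) = sumF f t + f t

  Tr : (s : ℕ) → .{{NonZero s}} → Carrier → Carrier
  Tr s x = sumF (λ i → pow x (2 ^ (i ℕ.* s))) (m / s)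

  count : {P : Carrier → Set} → Decidable P → ℕ
  count {P} P? = length (filter (λ i → P? (enum i)) (allFin (2 ^ m)))

gcd-nonZero : ∀ k m → .{{NonZero k}} → NonZero (gcd k m)
gcd-nonZero (suc k) m = ≢-nonZero (gcd[m,n]≢0 (suc k) m (inj₁ (λ ())))

-- Substituting x = u ⁻¹ turns x ^ 2 ^ k + x ^ (2 ^ k ∸ 1) = a into Lₐ u = 1 for the additive map
-- Lₐ u = a u ^ 2 ^ k + u, so the number of solutions is either 0 or the size of the kernel of Lₐ.
-- If a is not a (2 ^ k ∸ 1)-th power, that kernel is trivial and Lₐ is bijective: one solution.
-- If a = b ^ (2 ^ k ∸ 1), then w = b u turns the equation into ℘ k w = b with ℘ k w = w ^ 2 ^ k + w.
-- Its kernel is the subfield of order 2 ^ s, s = gcd k m, and its image lies in the kernel of Tr_s.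
-- A nonzero polynomial has at most its degree many roots, so the kernels of ℘ s and Tr_s have at most
-- 2 ^ s and 2 ^ (m ∸ s) elements; since |image| · |kernel| = 2 ^ m for an additive map, both bounds
-- are attained and the image of ℘ k is exactly the kernel of Tr_s.

module Submission where

open import Defs
open import Algebra.Bundles using (CommutativeMonoid)
import Algebra.Properties.CommutativeMonoid.Sum as CommutativeMonoidSum
import Algebra.Properties.CommutativeSemigroup as CommutativeSemigroupProperties
import Algebra.Properties.CommutativeSemiring.Exp as CommutativeSemiringExp
import Algebra.Properties.Group as GroupProperties
import Algebra.Properties.Loop as LoopProperties
import Algebra.Properties.Semiring.Mult as SemiringMult
import Algebra.Properties.Semiring.Sum as SemiringSum
open import Data.Empty using (⊥-elim)
open import Function using (_∘_)
open import Level using (0ℓ)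
open import Data.Fin using (Fin; zero; suc)
import Data.Fin.Properties as Finₚ
open import Data.Fin.Permutation using (permutation)
open import Data.List using (List; []; _∷_; length; filter; map; tabulate)
open import Data.List.Base using (allFin)
import Data.List.Properties as Listₚ
open import Data.List.Relation.Unary.All using (All; []; _∷_)
import Data.List.Relation.Unary.All.Properties as Allₚ
open import Data.List.Relation.Unary.AllPairs as AllPairs using (AllPairs; []; _∷_)
import Data.List.Relation.Unary.AllPairs.Properties as AllPairsₚ
import Data.List.Relation.Unary.Unique.Propositional.Properties as Uniqueₚ
open import Data.Maybe using (nothing)
open import Data.Nat as ℕ using (ℕ; zero; suc; _≤_; _<_; _>_; _∸_; z≤n; s≤s; NonZero)
import Data.Nat.Properties as ℕₚ
open import Data.Nat.Divisibility using (_∣_; divides; ∣-refl; ∣⇒≤)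
open import Data.Nat.DivMod using (_/_; m/n*n≡m; m≥n⇒m/n>0)
open import Data.Nat.GCD using (gcd; gcd[m,n]∣m; gcd[m,n]∣n; gcd-GCD; module Bézout)
open import Data.Product using (∃; _×_; _,_; proj₁; proj₂)
open import Data.Sum using (_⊎_; inj₁; inj₂)
open import Data.Unit using (tt)
open import Relation.Nullary using (¬_; Dec; yes; no)
open import Relation.Nullary.Decidable using (¬?; map′)
open import Relation.Unary using (Pred; Decidable; _⊆_; _≐_)
open import Relation.Binary.Core using (_Preserves_⟶_)
open import Relation.Binary.Definitions using (_Respects_)
open import Relation.Binary.PropositionalEquality as ≡ using (_≡_; cong; cong₂)
open ≡.≡-Reasoning using (step-≡-⟩) renaming (begin_ to begin-≡_; _∎ to _∎≡)
open import Tactic.RingSolver using (solve-∀)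
open import Tactic.RingSolver.Core.AlmostCommutativeRing using (AlmostCommutativeRing; fromCommutativeRing)

open SemiringSum ℕₚ.+-*-semiring using (sum; sum-cong-≋; ∑-distrib-+; ∑-comm; *-distribʳ-sum; sum-replicate-zero)

𝟙 : {A : Set} → Dec A → ℕ
𝟙 (yes _) = 1
𝟙 (no _)  = 0

𝟙-cong : {A B : Set} → (A → B) → (B → A) → (a : Dec A) (b : Dec B) → 𝟙 a ≡ 𝟙 b
𝟙-cong f g (yes _) (yes _) = ≡.refl
𝟙-cong f g (yes a) (no ¬b) = ⊥-elim (¬b (f a))
𝟙-cong f g (no ¬a) (yes b) = ⊥-elim (¬a (g b))
𝟙-cong f g (no _)  (no _)  = ≡.refl

𝟙-no : {A : Set} → ¬ A → (a : Dec A) → 𝟙 a ≡ 0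
𝟙-no ¬a (yes a) = ⊥-elim (¬a a)
𝟙-no ¬a (no _)  = ≡.refl

𝟙-mono : {A B : Set} → (A → B) → (a : Dec A) (b : Dec B) → 𝟙 a ≤ 𝟙 b
𝟙-mono f (yes _) (yes _) = ℕₚ.≤-refl
𝟙-mono f (yes a) (no ¬b) = ⊥-elim (¬b (f a))
𝟙-mono f (no _)  _       = z≤n

𝟙-strict : {A B : Set} → ¬ A → B → (a : Dec A) (b : Dec B) → 𝟙 a < 𝟙 b
𝟙-strict ¬a b (yes a) _      = ⊥-elim (¬a a)
𝟙-strict ¬a b (no _) (yes _) = ℕₚ.≤-refl
𝟙-strict ¬a b (no _) (no ¬b) = ⊥-elim (¬b b)

𝟙-+-𝟙-¬ : {A : Set} (a : Dec A) → 𝟙 a ℕ.+ 𝟙 (¬? a) ≡ 1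
𝟙-+-𝟙-¬ (yes _) = ≡.refl
𝟙-+-𝟙-¬ (no _)  = ≡.refl

sum-replicate-1 : ∀ n → sum {n} (λ _ → 1) ≡ n
sum-replicate-1 zero    = ≡.refl
sum-replicate-1 (suc n) = cong suc (sum-replicate-1 n)

sum-𝟙-≡ : ∀ {n} (j : Fin n) → sum (λ i → 𝟙 (i Finₚ.≟ j)) ≡ 1
sum-𝟙-≡ {suc n} zero = cong suc (≡.trans (sum-cong-≋ {n} (λ i → 𝟙-no (λ ()) (suc i Finₚ.≟ zero)))
                                          (sum-replicate-zero n))
sum-𝟙-≡ {suc n} (suc j) = ≡.trans
  (sum-cong-≋ (λ i → 𝟙-cong Finₚ.suc-injective (cong suc) (suc i Finₚ.≟ suc j) (i Finₚ.≟ j)))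
  (sum-𝟙-≡ j)

sum-mono : ∀ {n} {f g : Fin n → ℕ} → (∀ i → f i ≤ g i) → sum f ≤ sum g
sum-mono {zero}  f≤g = z≤n
sum-mono {suc n} f≤g = ℕₚ.+-mono-≤ (f≤g zero) (sum-mono (λ i → f≤g (suc i)))

sum-strict : ∀ {n} {f g : Fin n → ℕ} → (∀ i → f i ≤ g i) → ∀ j → f j < g j → sum f < sum g
sum-strict {suc n} f≤g zero    fj<gj = ℕₚ.+-mono-<-≤ fj<gj (sum-mono (λ i → f≤g (suc i)))
sum-strict {suc n} f≤g (suc j) fj<gj = ℕₚ.+-mono-≤-< (f≤g zero) (sum-strict (λ i → f≤g (suc i)) j fj<gj)

length-filter-tabulate : {A : Set} {P : Pred A 0ℓ} (P? : Decidable P) {n : ℕ} (f : Fin n → A) →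
                         length (filter P? (tabulate f)) ≡ sum (λ i → 𝟙 (P? (f i)))
length-filter-tabulate P? {zero}  f = ≡.refl
length-filter-tabulate P? {suc n} f with P? (f zero)
... | yes _ = cong suc (length-filter-tabulate P? (λ i → f (suc i)))
... | no _  = length-filter-tabulate P? (λ i → f (suc i))

1+n≤2^j*n : ∀ n .{{_ : NonZero n}} j .{{_ : NonZero j}} → suc n ≤ 2 ℕ.^ j ℕ.* n
1+n≤2^j*n n j = ℕₚ.≤-trans (ℕₚ.+-mono-≤ (ℕ.>-nonZero⁻¹ n) (ℕₚ.m≤m+n n 0))
                           (ℕₚ.*-monoˡ-≤ n (ℕₚ.^-monoʳ-≤ 2 (ℕ.>-nonZero⁻¹ j)))

m≤o∧n≤p∧m*n≡o*p⇒n≡p : ∀ {m n o p} .{{_ : NonZero o}} → m ≤ o → n ≤ p → m ℕ.* n ≡ o ℕ.* p → n ≡ p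
m≤o∧n≤p∧m*n≡o*p⇒n≡p {n = n} {o} m≤o n≤p m*n≡o*p with ℕₚ.m≤n⇒m<n∨m≡n n≤p
... | inj₂ n≡p = n≡p
... | inj₁ n<p = ⊥-elim (ℕₚ.<-irrefl m*n≡o*p (ℕₚ.≤-<-trans (ℕₚ.*-monoˡ-≤ n m≤o) (ℕₚ.*-monoʳ-< o n<p)))

module FieldRingIdentities {m : ℕ} (F : FiniteField m) where

  private
    R : AlmostCommutativeRing _ _
    R = fromCommutativeRing (FiniteField.commRing F) (λ _ → nothing)

  open AlmostCommutativeRing R

  square-expand : ∀ a b → (a + b) * (a + b) ≈ (a * a + b * b) + (a * b + a * b)
  square-expand = solve-∀ R

  synthetic-division : ∀ c x r v w → (c + r * v) + (x + r) * (v + x * w) ≈ (c + x * (v + (x + r) * w)) + (r * v + r * v)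
  synthetic-division = solve-∀ R

  coefficientwise-+ : ∀ a b x u v → (a + b) + x * (u + v) ≈ (a + x * u) + (b + x * v)
  coefficientwise-+ = solve-∀ R

module FiniteFieldTheory {m : ℕ} (F : FiniteField m) where

  open FiniteField F hiding (zero)
  open CommutativeSemiringExp commutativeSemiring
  open import Relation.Binary.Reasoning.Setoid setoid using (begin_; step-≈-⟩; step-≈-⟨; step-≡-⟨; _∎)

  private
    module RingIdentities = FieldRingIdentities F
    module +Σ = CommutativeMonoidSum +-commutativeMonoid
    module *Σ = CommutativeMonoidSum *-commutativeMonoid

  open SemiringMult semiring using (×1-homo-*) renaming (_×_ to _·_)
  open CommutativeSemigroupProperties +-commutativeSemigroup using ()
    renaming (interchange to +-interchange; xy∙z≈xz∙y to +-xy∙z≈xz∙y)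
  open CommutativeSemigroupProperties *-commutativeSemigroup using () renaming (x∙yz≈y∙xz to *-x∙yz≈y∙xz)
  open GroupProperties +-group using () renaming (∙-cancelʳ to +-cancelʳ)
  open LoopProperties (GroupProperties.loop +-group) using (identityˡ-unique; identityʳ-unique)

  x≈0⊎x≉0 : ∀ x → x ≈ 0# ⊎ x ≉ 0#
  x≈0⊎x≉0 x with x ≟ 0#
  ... | yes x≈0 = inj₁ x≈0
  ... | no x≉0  = inj₂ x≉0

  -- 0# ⁻¹ is the junk value 0#; this makes _⁻¹ an involution of the whole field.
  _⁻¹ : Carrier → Carrier
  x ⁻¹ with x ≟ 0#
  ... | yes _   = 0#
  ... | no x≉0  = proj₁ (inverse x x≉0)

  x*x⁻¹≈1 : ∀ {x} → x ≉ 0# → x * x ⁻¹ ≈ 1#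
  x*x⁻¹≈1 {x} x≉0 with x ≟ 0#
  ... | yes x≈0 = ⊥-elim (x≉0 x≈0)
  ... | no x≉0′ = proj₂ (inverse x x≉0′)

  x≈0⇒x⁻¹≈0 : ∀ {x} → x ≈ 0# → x ⁻¹ ≈ 0#
  x≈0⇒x⁻¹≈0 {x} x≈0 with x ≟ 0#
  ... | yes _   = refl
  ... | no x≉0  = ⊥-elim (x≉0 x≈0)

  x⁻¹*[x*y]≈y : ∀ {x} → x ≉ 0# → ∀ y → x ⁻¹ * (x * y) ≈ y
  x⁻¹*[x*y]≈y {x} x≉0 y = begin
    x ⁻¹ * (x * y)  ≈⟨ sym (*-assoc _ x y) ⟩
    (x ⁻¹ * x) * y  ≈⟨ *-congʳ (trans (*-comm _ x) (x*x⁻¹≈1 x≉0)) ⟩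
    1# * y          ≈⟨ *-identityˡ y ⟩
    y               ∎

  *-cancelˡ : ∀ {c x y} → c ≉ 0# → c * x ≈ c * y → x ≈ y
  *-cancelˡ {c} {x} {y} c≉0 cx≈cy = begin
    x               ≈⟨ sym (x⁻¹*[x*y]≈y c≉0 x) ⟩
    c ⁻¹ * (c * x)  ≈⟨ *-congˡ cx≈cy ⟩
    c ⁻¹ * (c * y)  ≈⟨ x⁻¹*[x*y]≈y c≉0 y ⟩
    y               ∎

  *-cancelʳ : ∀ {c x y} → c ≉ 0# → x * c ≈ y * c → x ≈ y
  *-cancelʳ {c} {x} {y} c≉0 xc≈yc = *-cancelˡ c≉0 (trans (*-comm c x) (trans xc≈yc (*-comm y c)))

  x≉0∧y≉0⇒x*y≉0 : ∀ {x y} → x ≉ 0# → y ≉ 0# → x * y ≉ 0#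
  x≉0∧y≉0⇒x*y≉0 {x} x≉0 y≉0 xy≈0 = y≉0 (*-cancelˡ x≉0 (trans xy≈0 (sym (zeroʳ x))))

  x≉0⇒x⁻¹≉0 : ∀ {x} → x ≉ 0# → x ⁻¹ ≉ 0#
  x≉0⇒x⁻¹≉0 {x} x≉0 x⁻¹≈0 = 1≉0 (begin
    1#         ≈⟨ sym (x*x⁻¹≈1 x≉0) ⟩
    x * x ⁻¹   ≈⟨ *-congˡ x⁻¹≈0 ⟩
    x * 0#     ≈⟨ zeroʳ x ⟩
    0#         ∎)

  ⁻¹-cong : ∀ {x y} → x ≈ y → x ⁻¹ ≈ y ⁻¹
  ⁻¹-cong {x} {y} x≈y with x≈0⊎x≉0 x
  ... | inj₁ x≈0 = trans (x≈0⇒x⁻¹≈0 x≈0) (sym (x≈0⇒x⁻¹≈0 (trans (sym x≈y) x≈0)))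
  ... | inj₂ x≉0 = *-cancelˡ x≉0 (trans (x*x⁻¹≈1 x≉0)
                    (sym (trans (*-congʳ x≈y) (x*x⁻¹≈1 (λ y≈0 → x≉0 (trans x≈y y≈0))))))

  ⁻¹-involutive : ∀ x → x ⁻¹ ⁻¹ ≈ x
  ⁻¹-involutive x with x≈0⊎x≉0 x
  ... | inj₁ x≈0 = trans (x≈0⇒x⁻¹≈0 (x≈0⇒x⁻¹≈0 x≈0)) (sym x≈0)
  ... | inj₂ x≉0 = *-cancelˡ (x≉0⇒x⁻¹≉0 x≉0)
                    (trans (x*x⁻¹≈1 (x≉0⇒x⁻¹≉0 x≉0)) (sym (trans (*-comm _ x) (x*x⁻¹≈1 x≉0))))

  1^n≈1 : ∀ n → 1# ^ n ≈ 1#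
  1^n≈1 zero    = refl
  1^n≈1 (suc n) = trans (*-identityˡ _) (1^n≈1 n)

  x≉0⇒x^n≉0 : ∀ {x} n → x ≉ 0# → x ^ n ≉ 0#
  x≉0⇒x^n≉0 zero    x≉0 = 1≉0
  x≉0⇒x^n≉0 (suc n) x≉0 = x≉0∧y≉0⇒x*y≉0 x≉0 (x≉0⇒x^n≉0 n x≉0)

  x^n≈0⇒x≈0 : ∀ {x} n → x ^ n ≈ 0# → x ≈ 0#
  x^n≈0⇒x≈0 {x} n xⁿ≈0 with x≈0⊎x≉0 x
  ... | inj₁ x≈0 = x≈0
  ... | inj₂ x≉0 = ⊥-elim (x≉0⇒x^n≉0 n x≉0 xⁿ≈0)

  pow≈^ : ∀ x n → pow F x n ≈ x ^ n
  pow≈^ x zero    = refl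
  pow≈^ x (suc n) = *-congˡ (pow≈^ x n)

  pow-cong : ∀ n {x y} → x ≈ y → pow F x n ≈ pow F y n
  pow-cong n {x} {y} x≈y = trans (pow≈^ x n) (trans (^-congˡ n x≈y) (sym (pow≈^ y n)))

  q : ℕ
  q = 2 ℕ.^ m

  index : Carrier → Fin q
  index x = proj₁ (enum-surj x)

  enum-index : ∀ x → enum (index x) ≈ x
  enum-index x = proj₂ (enum-surj x)

  record Permutation : Set where
    field
      to from   : Carrier → Carrier
      to-cong   : to Preserves _≈_ ⟶ _≈_
      from-cong : from Preserves _≈_ ⟶ _≈_
      from-to   : ∀ x → from (to x) ≈ x
      to-from   : ∀ x → to (from x) ≈ x

  open Permutation

  translation : Carrier → Permutation
  translation a = record
    { to        = _+ a
    ; from      = _+ - a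
    ; to-cong   = +-congʳ
    ; from-cong = +-congʳ
    ; from-to   = λ x → trans (+-assoc x a (- a)) (trans (+-congˡ (-‿inverseʳ a)) (+-identityʳ x))
    ; to-from   = λ x → trans (+-assoc x (- a) a) (trans (+-congˡ (-‿inverseˡ a)) (+-identityʳ x))
    }

  scaling : (c : Carrier) → c ≉ 0# → Permutation
  scaling c c≉0 = record
    { to        = c *_
    ; from      = c ⁻¹ *_
    ; to-cong   = *-congˡ
    ; from-cong = *-congˡ
    ; from-to   = x⁻¹*[x*y]≈y c≉0
    ; to-from   = λ x → trans (*-congʳ (sym (⁻¹-involutive c))) (x⁻¹*[x*y]≈y (x≉0⇒x⁻¹≉0 c≉0) x)
    }

  inversion : Permutation
  inversion = record
    { to        = _⁻¹
    ; from      = _⁻¹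
    ; to-cong   = ⁻¹-cong
    ; from-cong = ⁻¹-cong
    ; from-to   = ⁻¹-involutive
    ; to-from   = ⁻¹-involutive
    }

  module FieldSum {a ℓ} (M : CommutativeMonoid a ℓ) where
    open CommutativeMonoid M using () renaming (Carrier to A; _≈_ to _≈ᴹ_; trans to transᴹ)
    open CommutativeMonoidSum M using (∑-permute) renaming (sum to sumᴹ; sum-cong-≋ to sumᴹ-cong)

    ∑ᶠ : (Carrier → A) → A
    ∑ᶠ h = sumᴹ (λ i → h (enum i))

    ∑ᶠ-permute : (π : Permutation) (h : Carrier → A) → h Preserves _≈_ ⟶ _≈ᴹ_ →
                 ∑ᶠ h ≈ᴹ ∑ᶠ (h ∘ to π)
    ∑ᶠ-permute π h h-cong = transᴹ (∑-permute (λ i → h (enum i)) σ)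
                                   (sumᴹ-cong (λ i → h-cong (enum-index (to π (enum i)))))
      where
      σ = permutation (λ i → index (to π (enum i))) (λ i → index (from π (enum i)))
            (λ i → enum-inj _ _ (trans (enum-index _) (trans (to-cong π (enum-index _)) (to-from π _))))
            (λ i → enum-inj _ _ (trans (enum-index _) (trans (from-cong π (enum-index _)) (from-to π _))))

  open FieldSum ℕₚ.+-0-commutativeMonoid using () renaming (∑ᶠ to ∑ᶠℕ; ∑ᶠ-permute to ∑ᶠℕ-permute)

  private
    module +ᶠ = FieldSum +-commutativeMonoid
    module *ᶠ = FieldSum *-commutativeMonoid

  private variable
    P Q : Pred Carrier 0ℓ

  count≡∑ᶠ𝟙 : (P? : Decidable P) → count F P? ≡ ∑ᶠℕ (𝟙 ∘ P?)
  count≡∑ᶠ𝟙 P? = length-filter-tabulate (λ i → P? (enum i)) (λ i → i)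

  count-cong : (P? : Decidable P) (Q? : Decidable Q) → P ≐ Q → count F P? ≡ count F Q?
  count-cong P? Q? (P⊆Q , Q⊆P) = ≡.trans (count≡∑ᶠ𝟙 P?) (≡.trans
    (sum-cong-≋ (λ i → 𝟙-cong P⊆Q Q⊆P (P? (enum i)) (Q? (enum i)))) (≡.sym (count≡∑ᶠ𝟙 Q?)))

  count-mono : (P? : Decidable P) (Q? : Decidable Q) → P ⊆ Q → count F P? ≤ count F Q?
  count-mono P? Q? P⊆Q = ≡.subst₂ _≤_ (≡.sym (count≡∑ᶠ𝟙 P?)) (≡.sym (count≡∑ᶠ𝟙 Q?))
    (sum-mono (λ i → 𝟙-mono P⊆Q (P? (enum i)) (Q? (enum i))))

  count≤q : (P? : Decidable P) → count F P? ≤ q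
  count≤q P? = ℕₚ.≤-trans (Listₚ.length-filter (λ i → P? (enum i)) (allFin q))
                          (ℕₚ.≤-reflexive (Listₚ.length-tabulate (λ i → i)))

  count-∅ : (P? : Decidable P) → (∀ x → ¬ P x) → count F P? ≡ 0
  count-∅ P? ¬P = ≡.trans (count≡∑ᶠ𝟙 P?)
    (≡.trans (sum-cong-≋ (λ i → 𝟙-no (¬P (enum i)) (P? (enum i)))) (sum-replicate-zero q))

  count-≈ : ∀ y → count F (_≟ y) ≡ 1
  count-≈ y = ≡.trans (count≡∑ᶠ𝟙 (_≟ y)) (≡.trans
    (sum-cong-≋ (λ i → 𝟙-cong (λ x≈y → enum-inj _ _ (trans x≈y (sym (enum-index y))))
                              (λ { ≡.refl → enum-index y }) (enum i ≟ y) (i Finₚ.≟ index y)))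
    (sum-𝟙-≡ (index y)))

  count-+-count-∁ : (P? : Decidable P) → count F P? ℕ.+ count F (¬? ∘ P?) ≡ q
  count-+-count-∁ P? = begin-≡
    count F P? ℕ.+ count F (¬? ∘ P?)  ≡⟨ cong₂ ℕ._+_ (count≡∑ᶠ𝟙 P?) (count≡∑ᶠ𝟙 (¬? ∘ P?)) ⟩
    ∑ᶠℕ (𝟙 ∘ P?) ℕ.+ ∑ᶠℕ (𝟙 ∘ ¬? ∘ P?) ≡⟨ ≡.sym (∑-distrib-+ (λ i → 𝟙 (P? (enum i))) (λ i → 𝟙 (¬? (P? (enum i))))) ⟩
    sum (λ i → 𝟙 (P? (enum i)) ℕ.+ 𝟙 (¬? (P? (enum i)))) ≡⟨ sum-cong-≋ (λ i → 𝟙-+-𝟙-¬ (P? (enum i))) ⟩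
    sum {q} (λ _ → 1)                  ≡⟨ sum-replicate-1 q ⟩
    q                                  ∎≡

  count-permute : (P? : Decidable P) (Q? : Decidable Q) (π : Permutation) →
                  Q Respects _≈_ → P ≐ (Q ∘ to π) → count F P? ≡ count F Q?
  count-permute P? Q? π Q-resp P≐Qπ = begin-≡
    count F P?           ≡⟨ count-cong P? (Q? ∘ to π) P≐Qπ ⟩
    count F (Q? ∘ to π)  ≡⟨ count≡∑ᶠ𝟙 (Q? ∘ to π) ⟩
    ∑ᶠℕ (𝟙 ∘ Q? ∘ to π)  ≡⟨ ≡.sym (∑ᶠℕ-permute π (𝟙 ∘ Q?) (λ x≈y → 𝟙-cong (Q-resp x≈y) (Q-resp (sym x≈y)) _ _)) ⟩
    ∑ᶠℕ (𝟙 ∘ Q?)         ≡⟨ ≡.sym (count≡∑ᶠ𝟙 Q?) ⟩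
    count F Q?           ∎≡

  count-≥⇒⊇ : (P? : Decidable P) (Q? : Decidable Q) → P Respects _≈_ → Q Respects _≈_ →
              P ⊆ Q → count F Q? ≤ count F P? → Q ⊆ P
  count-≥⇒⊇ P? Q? P-resp Q-resp P⊆Q #Q≤#P {x} Qx with P? x
  ... | yes Px = Px
  ... | no ¬Px = ⊥-elim (ℕₚ.<⇒≱ #P<#Q #Q≤#P)
    where
    #P<#Q : count F P? < count F Q?
    #P<#Q = ≡.subst₂ _<_ (≡.sym (count≡∑ᶠ𝟙 P?)) (≡.sym (count≡∑ᶠ𝟙 Q?))
      (sum-strict (λ i → 𝟙-mono P⊆Q (P? (enum i)) (Q? (enum i))) (index x)
        (𝟙-strict (¬Px ∘ P-resp (enum-index x)) (Q-resp (sym (enum-index x)) Qx)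
                  (P? (enum (index x))) (Q? (enum (index x)))))

  distinct-witnesses : (P? : Decidable P) →
    ∃ λ (xs : List Carrier) → length xs ≡ count F P? × All P xs × AllPairs _≉_ xs
  distinct-witnesses P? = map enum is , Listₚ.length-map enum is , all-P , distinct
    where
    is = filter (λ i → P? (enum i)) (allFin q)
    all-P = Allₚ.map⁺ (Allₚ.all-filter (λ i → P? (enum i)) (allFin q))
    distinct = AllPairsₚ.map⁺ (AllPairs.map (λ i≢j → i≢j ∘ enum-inj _ _)
                 (Uniqueₚ.filter⁺ (λ i → P? (enum i)) (Uniqueₚ.allFin⁺ q)))

  ∑ᶠ-count-fibres : (L : Carrier → Carrier) → ∑ᶠℕ (λ t → count F (λ z → L z ≟ t)) ≡ q
  ∑ᶠ-count-fibres L = begin-≡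
    ∑ᶠℕ (λ t → count F (λ z → L z ≟ t))                   ≡⟨ sum-cong-≋ (λ i → count≡∑ᶠ𝟙 (λ z → L z ≟ enum i)) ⟩
    sum (λ i → sum (λ j → 𝟙 (L (enum j) ≟ enum i)))        ≡⟨ ∑-comm (λ i j → 𝟙 (L (enum j) ≟ enum i)) ⟩
    sum (λ j → sum (λ i → 𝟙 (L (enum j) ≟ enum i)))        ≡⟨ sum-cong-≋ (λ j → fibre-of-point (L (enum j))) ⟩
    sum {q} (λ _ → 1)                                      ≡⟨ sum-replicate-1 q ⟩
    q                                                      ∎≡
    where
    fibre-of-point : ∀ y → ∑ᶠℕ (λ t → 𝟙 (y ≟ t)) ≡ 1
    fibre-of-point y = ≡.trans (≡.sym (count≡∑ᶠ𝟙 (y ≟_)))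
                         (≡.trans (count-cong (y ≟_) (_≟ y) (sym , sym)) (count-≈ y))

  2^n·1≈[1+1]^n : ∀ n → (2 ℕ.^ n) · 1# ≈ (1# + 1#) ^ n
  2^n·1≈[1+1]^n zero    = +-identityʳ 1#
  2^n·1≈[1+1]^n (suc n) = trans (×1-homo-* 2 (2 ℕ.^ n)) (*-cong (+-congˡ (+-identityʳ 1#)) (2^n·1≈[1+1]^n n))

  -- Translation by 1# permutes the field, so ∑ x = ∑ (x + 1#) = ∑ x + q · 1#.
  q·1≈0 : q · 1# ≈ 0#
  q·1≈0 = identityʳ-unique (+ᶠ.∑ᶠ (λ x → x)) (q · 1#) (begin
    +ᶠ.∑ᶠ (λ x → x) + q · 1#                ≈⟨ +-congˡ (+Σ.sum-replicate q) ⟨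
    +ᶠ.∑ᶠ (λ x → x) + +ᶠ.∑ᶠ (λ _ → 1#)      ≈⟨ +Σ.∑-distrib-+ (λ i → enum i) (λ _ → 1#) ⟨
    +ᶠ.∑ᶠ (λ x → x + 1#)                    ≈⟨ +ᶠ.∑ᶠ-permute (translation 1#) (λ x → x) (λ x≈y → x≈y) ⟨
    +ᶠ.∑ᶠ (λ x → x)                         ∎)

  1+1≈0 : 1# + 1# ≈ 0#
  1+1≈0 = x^n≈0⇒x≈0 m (trans (sym (2^n·1≈[1+1]^n m)) q·1≈0)

  x+x≈0 : ∀ x → x + x ≈ 0#
  x+x≈0 x = begin
    x + x              ≈⟨ +-cong (*-identityˡ x) (*-identityˡ x) ⟨
    1# * x + 1# * x    ≈⟨ distribʳ x 1# 1# ⟨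
    (1# + 1#) * x      ≈⟨ *-congʳ 1+1≈0 ⟩
    0# * x             ≈⟨ zeroˡ x ⟩
    0#                 ∎

  x+y≈z⇒y≈x+z : ∀ {x y z} → x + y ≈ z → y ≈ x + z
  x+y≈z⇒y≈x+z {x} {y} {z} x+y≈z = begin
    y              ≈⟨ +-identityˡ y ⟨
    0# + y         ≈⟨ +-congʳ (x+x≈0 x) ⟨
    (x + x) + y    ≈⟨ +-assoc x x y ⟩
    x + (x + y)    ≈⟨ +-congˡ x+y≈z ⟩
    x + z          ∎

  x+y≈0⇒x≈y : ∀ {x y} → x + y ≈ 0# → x ≈ y
  x+y≈0⇒x≈y {x} {y} x+y≈0 = trans (x+y≈z⇒y≈x+z (trans (+-comm y x) x+y≈0)) (+-identityʳ y)

  x≈y⇒x+y≈0 : ∀ {x y} → x ≈ y → x + y ≈ 0#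
  x≈y⇒x+y≈0 {x} {y} x≈y = trans (+-congʳ x≈y) (x+x≈0 y)

  [x+y]²≈x²+y² : ∀ x y → (x + y) ^ 2 ≈ x ^ 2 + y ^ 2
  [x+y]²≈x²+y² x y = begin
    (x + y) ^ 2                         ≈⟨ x^2≈x*x (x + y) ⟩
    (x + y) * (x + y)                   ≈⟨ RingIdentities.square-expand x y ⟩
    (x * x + y * y) + (x * y + x * y)   ≈⟨ +-congˡ (x+x≈0 (x * y)) ⟩
    (x * x + y * y) + 0#                ≈⟨ +-identityʳ _ ⟩
    x * x + y * y                       ≈⟨ +-cong (x^2≈x*x x) (x^2≈x*x y) ⟨
    x ^ 2 + y ^ 2                       ∎
    where
    x^2≈x*x : ∀ x → x ^ 2 ≈ x * x
    x^2≈x*x x = *-congˡ (*-identityʳ x)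

  φ : ℕ → Carrier → Carrier
  φ j x = x ^ (2 ℕ.^ j)

  φ-cong : ∀ j → φ j Preserves _≈_ ⟶ _≈_
  φ-cong j = ^-congˡ (2 ℕ.^ j)

  φ-suc : ∀ j x → φ (suc j) x ≈ φ j (x ^ 2)
  φ-suc j x = sym (^-assocʳ x 2 (2 ℕ.^ j))

  φ-homo-+ : ∀ j x y → φ j (x + y) ≈ φ j x + φ j y
  φ-homo-+ zero    x y = trans (*-identityʳ _) (sym (+-cong (*-identityʳ x) (*-identityʳ y)))
  φ-homo-+ (suc j) x y = begin
    φ (suc j) (x + y)           ≈⟨ φ-suc j (x + y) ⟩
    φ j ((x + y) ^ 2)           ≈⟨ φ-cong j ([x+y]²≈x²+y² x y) ⟩
    φ j (x ^ 2 + y ^ 2)         ≈⟨ φ-homo-+ j _ _ ⟩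
    φ j (x ^ 2) + φ j (y ^ 2)   ≈⟨ +-cong (φ-suc j x) (φ-suc j y) ⟨
    φ (suc j) x + φ (suc j) y   ∎

  φ-homo-* : ∀ j x y → φ j (x * y) ≈ φ j x * φ j y
  φ-homo-* j x y = ^-distrib-* x y (2 ℕ.^ j)

  φ-homo-ℕ+ : ∀ a b x → φ (a ℕ.+ b) x ≈ φ b (φ a x)
  φ-homo-ℕ+ a b x = trans (^-congʳ x (ℕₚ.^-distribˡ-+-* 2 a b)) (sym (^-assocʳ x (2 ℕ.^ a) (2 ℕ.^ b)))

  φ-injective : ∀ j {x y} → φ j x ≈ φ j y → x ≈ y
  φ-injective j {x} {y} φx≈φy = x+y≈0⇒x≈y (x^n≈0⇒x≈0 (2 ℕ.^ j) (trans (φ-homo-+ j x y) (x≈y⇒x+y≈0 φx≈φy)))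

  -- 0# is replaced by 1#, so that the product of unitPart over the field is the product of its units.
  unitPart : Carrier → Carrier
  unitPart y with y ≟ 0#
  ... | yes _ = 1#
  ... | no _  = y

  unitPart-cong : unitPart Preserves _≈_ ⟶ _≈_
  unitPart-cong {y} {y′} y≈y′ with y ≟ 0# | y′ ≟ 0#
  ... | yes _   | yes _    = refl
  ... | yes y≈0 | no y′≉0  = ⊥-elim (y′≉0 (trans (sym y≈y′) y≈0))
  ... | no y≉0  | yes y′≈0 = ⊥-elim (y≉0 (trans y≈y′ y′≈0))
  ... | no _    | no _     = y≈y′

  unitPart≉0 : ∀ y → unitPart y ≉ 0#
  unitPart≉0 y with y ≟ 0#
  ... | yes _  = 1≉0
  ... | no y≉0 = y≉0

  unitPart-* : ∀ {x} → x ≉ 0# → ∀ y → unitPart (x * y) ≈ x ^ 𝟙 (¬? (y ≟ 0#)) * unitPart y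
  unitPart-* {x} x≉0 y with y ≟ 0# | (x * y) ≟ 0#
  ... | yes _   | yes _    = sym (*-identityˡ 1#)
  ... | yes y≈0 | no xy≉0  = ⊥-elim (xy≉0 (trans (*-congˡ y≈0) (zeroʳ x)))
  ... | no y≉0  | yes xy≈0 = ⊥-elim (x≉0∧y≉0⇒x*y≉0 x≉0 y≉0 xy≈0)
  ... | no _    | no _     = *-congʳ (sym (*-identityʳ x))

  product-^ : ∀ {n} x (f : Fin n → ℕ) → *Σ.sum (λ i → x ^ f i) ≈ x ^ sum f
  product-^ {zero}  x f = refl
  product-^ {suc n} x f = trans (*-congˡ (product-^ x (λ i → f (suc i)))) (sym (^-homo-* x (f zero) _))

  product-≉0 : ∀ {n} (f : Fin n → Carrier) → (∀ i → f i ≉ 0#) → *Σ.sum f ≉ 0#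
  product-≉0 {zero}  f f≉0 = 1≉0
  product-≉0 {suc n} f f≉0 = x≉0∧y≉0⇒x*y≉0 (f≉0 zero) (product-≉0 (λ i → f (suc i)) (λ i → f≉0 (suc i)))

  #units : ℕ
  #units = count F (¬? ∘ (_≟ 0#))

  1+#units≡q : 1 ℕ.+ #units ≡ q
  1+#units≡q = ≡.trans (cong (ℕ._+ #units) (≡.sym (count-≈ 0#))) (count-+-count-∁ (_≟ 0#))

  -- Multiplication by a unit x permutes the units, so it fixes their product U, while it also scales U by x ^ #units.
  x^#units≈1 : ∀ {x} → x ≉ 0# → x ^ #units ≈ 1#
  x^#units≈1 {x} x≉0 = *-cancelˡ (product-≉0 _ (unitPart≉0 ∘ enum)) (begin
    U * x ^ #units   ≈⟨ *-comm U _ ⟩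
    x ^ #units * U   ≈⟨ U≈x^#units*U ⟨
    U                ≈⟨ *-identityʳ U ⟨
    U * 1#           ∎)
    where
    U = *ᶠ.∑ᶠ unitPart
    U≈x^#units*U : U ≈ x ^ #units * U
    U≈x^#units*U = begin
      U                                                          ≈⟨ *ᶠ.∑ᶠ-permute (scaling x x≉0) unitPart unitPart-cong ⟩
      *ᶠ.∑ᶠ (unitPart ∘ (x *_))                                   ≈⟨ *Σ.sum-cong-≋ (unitPart-* x≉0 ∘ enum) ⟩
      *Σ.sum (λ i → x ^ 𝟙 (¬? (enum i ≟ 0#)) * unitPart (enum i)) ≈⟨ *Σ.∑-distrib-+ (λ i → x ^ 𝟙 (¬? (enum i ≟ 0#))) _ ⟩
      *Σ.sum (λ i → x ^ 𝟙 (¬? (enum i ≟ 0#))) * U                 ≈⟨ *-congʳ (product-^ x (λ i → 𝟙 (¬? (enum i ≟ 0#)))) ⟩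
      x ^ ∑ᶠℕ (𝟙 ∘ ¬? ∘ (_≟ 0#)) * U                             ≈⟨ *-congʳ (^-congʳ x (count≡∑ᶠ𝟙 (¬? ∘ (_≟ 0#)))) ⟨
      x ^ #units * U                                              ∎

  fermat : ∀ x → x ^ q ≈ x
  fermat x with x≈0⊎x≉0 x
  ... | inj₁ x≈0 = trans (^-congʳ x (≡.sym 1+#units≡q)) (trans (*-congʳ x≈0) (trans (zeroˡ _) (sym x≈0)))
  ... | inj₂ x≉0 = trans (^-congʳ x (≡.sym 1+#units≡q)) (trans (*-congˡ (x^#units≈1 x≉0)) (*-identityʳ x))

  module AdditiveMap (L : Carrier → Carrier) (L-cong : L Preserves _≈_ ⟶ _≈_)
                     (L-homo-+ : ∀ x y → L (x + y) ≈ L x + L y) where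

    L-0 : L 0# ≈ 0#
    L-0 = identityʳ-unique (L 0#) (L 0#) (sym (trans (L-cong (sym (+-identityʳ 0#))) (L-homo-+ 0# 0#)))

    Image : Pred Carrier 0ℓ
    Image t = ∃ λ x → L x ≈ t

    image? : Decidable Image
    image? t = map′ (λ (i , Li≈t) → enum i , Li≈t)
                        (λ (x , Lx≈t) → index x , trans (L-cong (enum-index x)) Lx≈t)
                        (Finₚ.any? (λ i → L (enum i) ≟ t))

    Image-resp : Image Respects _≈_
    Image-resp t≈t′ (x , Lx≈t) = x , trans Lx≈t t≈t′

    image-size : ℕ
    image-size = count F image?

    kernel-size : ℕ
    kernel-size = count F (λ z → L z ≟ 0#)

    count-fibre-image : ∀ {t} → Image t → count F (λ z → L z ≟ t) ≡ kernel-size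
    count-fibre-image {t} (x₀ , Lx₀≈t) = ≡.sym (count-permute (λ z → L z ≟ 0#) (λ z → L z ≟ t)
      (translation x₀) (λ z≈z′ Lz≈t → trans (L-cong (sym z≈z′)) Lz≈t) (kernel⇒fibre , fibre⇒kernel))
      where
      kernel⇒fibre : ∀ {z} → L z ≈ 0# → L (z + x₀) ≈ t
      kernel⇒fibre {z} Lz≈0 = trans (L-homo-+ z x₀) (trans (+-cong Lz≈0 Lx₀≈t) (+-identityˡ t))
      fibre⇒kernel : ∀ {z} → L (z + x₀) ≈ t → L z ≈ 0#
      fibre⇒kernel {z} Lz+x₀≈t = identityˡ-unique (L z) (L x₀) (trans (sym (L-homo-+ z x₀)) (trans Lz+x₀≈t (sym Lx₀≈t)))

    count-fibre-∉image : ∀ {t} → ¬ Image t → count F (λ z → L z ≟ t) ≡ 0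
    count-fibre-∉image {t} t∉image = count-∅ (λ z → L z ≟ t) (λ z Lz≈t → t∉image (z , Lz≈t))

    image-size*kernel-size≡q : image-size ℕ.* kernel-size ≡ q
    image-size*kernel-size≡q = begin-≡
      image-size ℕ.* kernel-size                       ≡⟨ cong (ℕ._* kernel-size) (count≡∑ᶠ𝟙 image?) ⟩
      ∑ᶠℕ (𝟙 ∘ image?) ℕ.* kernel-size                 ≡⟨ *-distribʳ-sum kernel-size (λ i → 𝟙 (image? (enum i))) ⟩
      ∑ᶠℕ (λ t → 𝟙 (image? t) ℕ.* kernel-size)         ≡⟨ sum-cong-≋ (fibre-size ∘ enum) ⟩
      ∑ᶠℕ (λ t → count F (λ z → L z ≟ t))              ≡⟨ ∑ᶠ-count-fibres L ⟩
      q                                                ∎≡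
      where
      fibre-size : ∀ t → 𝟙 (image? t) ℕ.* kernel-size ≡ count F (λ z → L z ≟ t)
      fibre-size t with image? t
      ... | yes t∈image = ≡.trans (ℕₚ.+-identityʳ kernel-size) (≡.sym (count-fibre-image t∈image))
      ... | no t∉image  = ≡.sym (count-fibre-∉image t∉image)

    kernel-size≡1⇒surjective : kernel-size ≡ 1 → ∀ t → Image t
    kernel-size≡1⇒surjective ∣ker∣≡1 t = count-≥⇒⊇ image? (λ _ → yes tt) Image-resp (λ _ _ → tt) (λ _ → tt)
      (ℕₚ.≤-trans (count≤q (λ _ → yes tt)) (ℕₚ.≤-reflexive (≡.sym image-size≡q))) tt
      where
      image-size≡q : image-size ≡ q
      image-size≡q = ≡.trans (≡.sym (ℕₚ.*-identityʳ image-size))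
                             (≡.subst (λ c → image-size ℕ.* c ≡ q) ∣ker∣≡1 image-size*kernel-size≡q)

  -- Polynomials are coefficient lists, constant term first.
  eval : List Carrier → Carrier → Carrier
  eval []      x = 0#
  eval (c ∷ p) x = c + x * eval p x

  IsZero : List Carrier → Set
  IsZero = All (_≈ 0#)

  -- Synthetic division by x - r, which is x + r in characteristic 2.
  quotient : Carrier → List Carrier → List Carrier
  quotient r []          = []
  quotient r (c ∷ [])    = []
  quotient r (c ∷ d ∷ p) = eval (d ∷ p) r ∷ quotient r (d ∷ p)

  eval-quotient : ∀ r p x → eval p x ≈ eval p r + (x + r) * eval (quotient r p) x
  eval-quotient r []          x = sym (trans (+-congˡ (zeroʳ _)) (+-identityʳ 0#))
  eval-quotient r (c ∷ [])    x = begin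
    c + x * 0#                   ≈⟨ +-congˡ (zeroʳ x) ⟩
    c + 0#                       ≈⟨ +-congˡ (zeroʳ r) ⟨
    c + r * 0#                   ≈⟨ +-identityʳ _ ⟨
    (c + r * 0#) + 0#            ≈⟨ +-congˡ (zeroʳ (x + r)) ⟨
    (c + r * 0#) + (x + r) * 0#  ∎
  eval-quotient r (c ∷ d ∷ p) x = begin
    c + x * eval (d ∷ p) x                               ≈⟨ +-congˡ (*-congˡ (eval-quotient r (d ∷ p) x)) ⟩
    c + x * (v + (x + r) * w)                            ≈⟨ +-identityʳ _ ⟨
    (c + x * (v + (x + r) * w)) + 0#                     ≈⟨ +-congˡ (x+x≈0 (r * v)) ⟨
    (c + x * (v + (x + r) * w)) + (r * v + r * v)        ≈⟨ RingIdentities.synthetic-division c x r v w ⟨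
    (c + r * v) + (x + r) * (v + x * w)                  ∎
    where
    v = eval (d ∷ p) r
    w = eval (quotient r (d ∷ p)) x

  length-quotient : ∀ r p → length (quotient r p) ≡ ℕ.pred (length p)
  length-quotient r []          = ≡.refl
  length-quotient r (c ∷ [])    = ≡.refl
  length-quotient r (c ∷ d ∷ p) = cong suc (length-quotient r (d ∷ p))

  IsZero-quotient⇒IsZero : ∀ r p → IsZero (quotient r p) → eval p r ≈ 0# → IsZero p
  IsZero-quotient⇒IsZero r []          _          _     = []
  IsZero-quotient⇒IsZero r (c ∷ [])    _          pr≈0 = trans (sym (trans (+-congˡ (zeroʳ r)) (+-identityʳ c))) pr≈0 ∷ []
  IsZero-quotient⇒IsZero r (c ∷ d ∷ p) (v≈0 ∷ z) pr≈0 =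
    trans (sym (trans (+-congˡ (trans (*-congˡ v≈0) (zeroʳ r))) (+-identityʳ c))) pr≈0
      ∷ IsZero-quotient⇒IsZero r (d ∷ p) z v≈0

  roots⇒IsZero : ∀ rs p → AllPairs _≉_ rs → All (λ x → eval p x ≈ 0#) rs → length p ≤ length rs → IsZero p
  roots⇒IsZero []       []      _              _             _ = []
  roots⇒IsZero (r ∷ rs) p (r≉rs ∷ distinct) (pr≈0 ∷ prs≈0) ∣p∣≤∣rs∣ =
    IsZero-quotient⇒IsZero r p (roots⇒IsZero rs (quotient r p) distinct (quotient-roots rs r≉rs prs≈0) ∣p/r∣≤∣rs∣) pr≈0
    where
    ∣p/r∣≤∣rs∣ : length (quotient r p) ≤ length rs
    ∣p/r∣≤∣rs∣ = ≡.subst (_≤ length rs) (≡.sym (length-quotient r p)) (ℕₚ.pred-mono-≤ ∣p∣≤∣rs∣)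
    quotient-roots : ∀ xs → All (r ≉_) xs → All (λ x → eval p x ≈ 0#) xs → All (λ x → eval (quotient r p) x ≈ 0#) xs
    quotient-roots []       []            []            = []
    quotient-roots (x ∷ xs) (r≉x ∷ r≉xs) (px≈0 ∷ pxs) =
      *-cancelˡ x+r≉0 (trans [x+r]*w≈0 (sym (zeroʳ _))) ∷ quotient-roots xs r≉xs pxs
      where
      x+r≉0 : x + r ≉ 0#
      x+r≉0 x+r≈0 = r≉x (sym (x+y≈0⇒x≈y x+r≈0))
      [x+r]*w≈0 : (x + r) * eval (quotient r p) x ≈ 0#
      [x+r]*w≈0 = identityˡ-unique _ (eval p r)
        (trans (+-comm _ _) (trans (sym (eval-quotient r p x)) (trans px≈0 (sym pr≈0))))

  count-roots<length : ∀ p → ¬ IsZero p → count F (λ x → eval p x ≟ 0#) < length p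
  count-roots<length p p≉0 with ℕₚ.<-≤-connex (count F (λ x → eval p x ≟ 0#)) (length p)
  ... | inj₁ #roots<∣p∣ = #roots<∣p∣
  ... | inj₂ ∣p∣≤#roots with distinct-witnesses (λ x → eval p x ≟ 0#)
  ... | rs , ∣rs∣≡#roots , roots , distinct =
    ⊥-elim (p≉0 (roots⇒IsZero rs p distinct roots (≡.subst (length p ≤_) (≡.sym ∣rs∣≡#roots) ∣p∣≤#roots)))

  monomial : ℕ → List Carrier
  monomial zero    = 1# ∷ []
  monomial (suc e) = 0# ∷ monomial e

  eval-monomial : ∀ e x → eval (monomial e) x ≈ x ^ e
  eval-monomial zero    x = trans (+-congˡ (zeroʳ x)) (+-identityʳ 1#)
  eval-monomial (suc e) x = trans (+-identityˡ _) (*-congˡ (eval-monomial e x))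

  length-monomial : ∀ e → length (monomial e) ≡ suc e
  length-monomial zero    = ≡.refl
  length-monomial (suc e) = cong suc (length-monomial e)

  monomial-≉0 : ∀ e → ¬ IsZero (monomial e)
  monomial-≉0 zero    (1≈0 ∷ []) = 1≉0 1≈0
  monomial-≉0 (suc e) (_ ∷ z)    = monomial-≉0 e z

  infixl 6 _⊕_
  _⊕_ : List Carrier → List Carrier → List Carrier
  []       ⊕ p₂       = p₂
  (a ∷ p₁) ⊕ []       = a ∷ p₁
  (a ∷ p₁) ⊕ (b ∷ p₂) = (a + b) ∷ (p₁ ⊕ p₂)

  eval-⊕ : ∀ p₁ p₂ x → eval (p₁ ⊕ p₂) x ≈ eval p₁ x + eval p₂ x
  eval-⊕ []       p₂       x = sym (+-identityˡ _)
  eval-⊕ (a ∷ p₁) []       x = sym (+-identityʳ _)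
  eval-⊕ (a ∷ p₁) (b ∷ p₂) x =
    trans (+-congˡ (*-congˡ (eval-⊕ p₁ p₂ x))) (RingIdentities.coefficientwise-+ a b x (eval p₁ x) (eval p₂ x))

  length-⊕-monomial : ∀ p e → length p ≤ e → length (p ⊕ monomial e) ≡ suc e
  length-⊕-monomial []      e       _          = length-monomial e
  length-⊕-monomial (a ∷ p) (suc e) (s≤s ∣p∣≤e) = cong suc (length-⊕-monomial p e ∣p∣≤e)

  ⊕-monomial-≉0 : ∀ p e → length p ≤ e → ¬ IsZero (p ⊕ monomial e)
  ⊕-monomial-≉0 []      e       _          = monomial-≉0 e
  ⊕-monomial-≉0 (a ∷ p) (suc e) (s≤s ∣p∣≤e) (_ ∷ z) = ⊕-monomial-≉0 p e ∣p∣≤e z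

  count-roots-+-monomial : ∀ p e → length p ≤ e → count F (λ x → (eval p x + x ^ e) ≟ 0#) ≤ e
  count-roots-+-monomial p e ∣p∣≤e = ℕₚ.≤-pred (≡.subst₂ _≤_
    (cong suc (count-cong (λ x → eval (p ⊕ monomial e) x ≟ 0#) (λ x → (eval p x + x ^ e) ≟ 0#) (same-roots′ , same-roots)))
    (length-⊕-monomial p e ∣p∣≤e)
    (count-roots<length (p ⊕ monomial e) (⊕-monomial-≉0 p e ∣p∣≤e)))
    where
    eval-p⊕xᵉ : ∀ x → eval (p ⊕ monomial e) x ≈ eval p x + x ^ e
    eval-p⊕xᵉ x = trans (eval-⊕ p (monomial e) x) (+-congˡ (eval-monomial e x))
    same-roots : ∀ {x} → eval p x + x ^ e ≈ 0# → eval (p ⊕ monomial e) x ≈ 0#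
    same-roots {x} = trans (eval-p⊕xᵉ x)
    same-roots′ : ∀ {x} → eval (p ⊕ monomial e) x ≈ 0# → eval p x + x ^ e ≈ 0#
    same-roots′ {x} = trans (sym (eval-p⊕xᵉ x))

  -- For j ∣ m, Fixed j is the subfield of order 2 ^ j.
  Fixed : ℕ → Carrier → Set
  Fixed j w = φ j w ≈ w

  Fixed-0 : ∀ w → Fixed 0 w
  Fixed-0 w = *-identityʳ w

  Fixed-m : ∀ w → Fixed m w
  Fixed-m = fermat

  Fixed-+ : ∀ a b {w} → Fixed a w → Fixed b w → Fixed (a ℕ.+ b) w
  Fixed-+ a b {w} a-fixed b-fixed = trans (φ-homo-ℕ+ a b w) (trans (φ-cong b a-fixed) b-fixed)

  Fixed-∸ : ∀ a b {w} → Fixed (a ℕ.+ b) w → Fixed b w → Fixed a w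
  Fixed-∸ a b {w} a+b-fixed b-fixed = φ-injective b (trans (sym (φ-homo-ℕ+ a b w)) (trans a+b-fixed (sym b-fixed)))

  Fixed-* : ∀ c a {w} → Fixed a w → Fixed (c ℕ.* a) w
  Fixed-* zero    a {w} _       = Fixed-0 w
  Fixed-* (suc c) a {w} a-fixed = Fixed-+ a (c ℕ.* a) a-fixed (Fixed-* c a a-fixed)

  Fixed-∣ : ∀ {a b w} → a ∣ b → Fixed a w → Fixed b w
  Fixed-∣ {a} (divides c ≡.refl) = Fixed-* c a

  Fixed-gcd : ∀ a b {w} → Fixed a w → Fixed b w → Fixed (gcd a b) w
  Fixed-gcd a b {w} a-fixed b-fixed with Bézout.identity (gcd-GCD a b)
  ... | Bézout.Identity.+- x y d+yb≡xa =
    Fixed-∸ (gcd a b) (y ℕ.* b) (≡.subst (λ j → Fixed j w) (≡.sym d+yb≡xa) (Fixed-* x a a-fixed)) (Fixed-* y b b-fixed)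
  ... | Bézout.Identity.-+ x y d+xa≡yb =
    Fixed-∸ (gcd a b) (x ℕ.* a) (≡.subst (λ j → Fixed j w) (≡.sym d+xa≡yb) (Fixed-* y b b-fixed)) (Fixed-* x a a-fixed)

  ℘ : ℕ → Carrier → Carrier
  ℘ j w = φ j w + w

  ℘-cong : ∀ j → ℘ j Preserves _≈_ ⟶ _≈_
  ℘-cong j x≈y = +-cong (φ-cong j x≈y) x≈y

  ℘-homo-+ : ∀ j x y → ℘ j (x + y) ≈ ℘ j x + ℘ j y
  ℘-homo-+ j x y = trans (+-congʳ (φ-homo-+ j x y)) (+-interchange (φ j x) (φ j y) x y)

  ℘≈0⇔Fixed : ∀ j w → (℘ j w ≈ 0# → Fixed j w) × (Fixed j w → ℘ j w ≈ 0#)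
  ℘≈0⇔Fixed j w = x+y≈0⇒x≈y , x≈y⇒x+y≈0

  count-℘≈0≤ : ∀ j → .{{NonZero j}} → count F (λ w → ℘ j w ≟ 0#) ≤ 2 ℕ.^ j
  count-℘≈0≤ j = ℕₚ.≤-trans
    (count-mono (λ w → ℘ j w ≟ 0#) (λ x → (eval (monomial 1) x + x ^ 2 ℕ.^ j) ≟ 0#) (λ {w} → trans (℘≈eval w)))
    (count-roots-+-monomial (monomial 1) (2 ℕ.^ j) (ℕₚ.^-monoʳ-≤ 2 (ℕ.>-nonZero⁻¹ j)))
    where
    ℘≈eval : ∀ w → eval (monomial 1) w + w ^ 2 ℕ.^ j ≈ ℘ j w
    ℘≈eval w = trans (+-comm _ _) (+-congˡ (trans (eval-monomial 1 w) (*-identityʳ w)))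

  sumF-cong : ∀ {f g : ℕ → Carrier} t → (∀ i → f i ≈ g i) → sumF F f t ≈ sumF F g t
  sumF-cong zero    f≈g = refl
  sumF-cong (suc t) f≈g = +-cong (sumF-cong t f≈g) (f≈g t)

  sumF-homo-+ : ∀ (f g : ℕ → Carrier) t → sumF F (λ i → f i + g i) t ≈ sumF F f t + sumF F g t
  sumF-homo-+ f g zero    = sym (+-identityʳ 0#)
  sumF-homo-+ f g (suc t) = trans (+-congʳ (sumF-homo-+ f g t)) (+-interchange _ _ _ _)

  sumF-shift : ∀ (f : ℕ → Carrier) t → sumF F (f ∘ suc) t + f 0 ≈ sumF F f t + f t
  sumF-shift f zero    = refl
  sumF-shift f (suc t) = trans (+-xy∙z≈xz∙y _ _ _) (+-congʳ (sumF-shift f t))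

  module RelativeTrace (s : ℕ) .{{_ : NonZero s}} (s∣m : s ∣ m) .{{_ : NonZero m}} where

    private
      n : ℕ
      n = m / s

      n*s≡m : n ℕ.* s ≡ m
      n*s≡m = m/n*n≡m s∣m

      instance
        n≢0 : NonZero n
        n≢0 = ℕ.>-nonZero (m≥n⇒m/n>0 (∣⇒≤ s∣m))

      pred[n]*s≡m∸s : ℕ.pred n ℕ.* s ≡ m ∸ s
      pred[n]*s≡m∸s = ≡.trans (≡.sym (ℕₚ.m+n∸m≡n s _))
                            (cong (_∸ s) (≡.trans (cong (ℕ._* s) (ℕₚ.suc-pred n)) n*s≡m))

      conjugate : Carrier → ℕ → Carrier
      conjugate x i = φ (i ℕ.* s) x

    Tr≈∑conjugates : ∀ x → Tr F s x ≈ sumF F (conjugate x) n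
    Tr≈∑conjugates x = sumF-cong n (λ i → pow≈^ x (2 ℕ.^ (i ℕ.* s)))

    Tr-cong : ∀ {x y} → x ≈ y → Tr F s x ≈ Tr F s y
    Tr-cong {x} {y} x≈y = trans (Tr≈∑conjugates x) (trans (sumF-cong n (λ i → φ-cong (i ℕ.* s) x≈y)) (sym (Tr≈∑conjugates y)))

    Tr-homo-+ : ∀ x y → Tr F s (x + y) ≈ Tr F s x + Tr F s y
    Tr-homo-+ x y = begin
      Tr F s (x + y)                                              ≈⟨ Tr≈∑conjugates (x + y) ⟩
      sumF F (conjugate (x + y)) n                                ≈⟨ sumF-cong n (λ i → φ-homo-+ (i ℕ.* s) x y) ⟩
      sumF F (λ i → conjugate x i + conjugate y i) n              ≈⟨ sumF-homo-+ (conjugate x) (conjugate y) n ⟩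
      sumF F (conjugate x) n + sumF F (conjugate y) n             ≈⟨ +-cong (Tr≈∑conjugates x) (Tr≈∑conjugates y) ⟨
      Tr F s x + Tr F s y                                         ∎

    -- φ s shifts the conjugates cyclically, because conjugate w n = φ m w ≈ w = conjugate w 0.
    Tr∘φ≈Tr : ∀ w → Tr F s (φ s w) ≈ Tr F s w
    Tr∘φ≈Tr w = +-cancelʳ (conjugate w 0) _ _ (begin
      Tr F s (φ s w) + conjugate w 0                  ≈⟨ +-congʳ (Tr≈∑conjugates (φ s w)) ⟩
      sumF F (conjugate (φ s w)) n + conjugate w 0    ≈⟨ +-congʳ (sumF-cong n (λ i → φ-homo-ℕ+ s (i ℕ.* s) w)) ⟨
      sumF F (conjugate w ∘ suc) n + conjugate w 0    ≈⟨ sumF-shift (conjugate w) n ⟩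
      sumF F (conjugate w) n + conjugate w n          ≈⟨ +-cong (sym (Tr≈∑conjugates w)) conjugate-n≈conjugate-0 ⟩
      Tr F s w + conjugate w 0                        ∎)
      where
      conjugate-n≈conjugate-0 : conjugate w n ≈ conjugate w 0
      conjugate-n≈conjugate-0 = trans (≡.subst (λ j → Fixed j w) (≡.sym n*s≡m) (Fixed-m w)) (sym (Fixed-0 w))

    Tr∘φ[c*s]≈Tr : ∀ c w → Tr F s (φ (c ℕ.* s) w) ≈ Tr F s w
    Tr∘φ[c*s]≈Tr zero    w = Tr-cong (Fixed-0 w)
    Tr∘φ[c*s]≈Tr (suc c) w = trans (Tr-cong (φ-homo-ℕ+ s (c ℕ.* s) w)) (trans (Tr∘φ[c*s]≈Tr c (φ s w)) (Tr∘φ≈Tr w))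

    Tr∘℘≈0 : ∀ {j} → s ∣ j → ∀ w → Tr F s (℘ j w) ≈ 0#
    Tr∘℘≈0 (divides c ≡.refl) w = trans (Tr-homo-+ _ w) (x≈y⇒x+y≈0 (Tr∘φ[c*s]≈Tr c w))

    tracePolynomial : ℕ → List Carrier
    tracePolynomial zero    = []
    tracePolynomial (suc t) = tracePolynomial t ⊕ monomial (2 ℕ.^ (t ℕ.* s))

    eval-tracePolynomial : ∀ t x → eval (tracePolynomial t) x ≈ sumF F (conjugate x) t
    eval-tracePolynomial zero    x = refl
    eval-tracePolynomial (suc t) x =
      trans (eval-⊕ (tracePolynomial t) _ x) (+-cong (eval-tracePolynomial t x) (eval-monomial (2 ℕ.^ (t ℕ.* s)) x))

    length-tracePolynomial : ∀ t → length (tracePolynomial t) ≤ 2 ℕ.^ (t ℕ.* s)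
    length-tracePolynomial zero    = z≤n
    length-tracePolynomial (suc t) = ≡.subst₂ _≤_
      (≡.sym (length-⊕-monomial (tracePolynomial t) _ (length-tracePolynomial t)))
      (≡.sym (ℕₚ.^-distribˡ-+-* 2 s (t ℕ.* s)))
      (1+n≤2^j*n (2 ℕ.^ (t ℕ.* s)) {{ℕ.>-nonZero (ℕₚ.m^n>0 2 (t ℕ.* s))}} s)

    count-Tr≈0≤ : count F (λ x → Tr F s x ≟ 0#) ≤ 2 ℕ.^ (m ∸ s)
    count-Tr≈0≤ = ≡.subst (λ j → count F (λ x → Tr F s x ≟ 0#) ≤ 2 ℕ.^ j) pred[n]*s≡m∸s
      (ℕₚ.≤-trans (count-mono (λ x → Tr F s x ≟ 0#) (λ x → (eval p x + x ^ 2 ℕ.^ e) ≟ 0#)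
                              (λ {x} → trans (sym (Tr≈eval x))))
                  (count-roots-+-monomial p (2 ℕ.^ e) (length-tracePolynomial (ℕ.pred n))))
      where
      e = ℕ.pred n ℕ.* s
      p = tracePolynomial (ℕ.pred n)
      Tr≈eval : ∀ x → Tr F s x ≈ eval p x + x ^ 2 ℕ.^ e
      Tr≈eval x = begin
        Tr F s x                                        ≈⟨ Tr≈∑conjugates x ⟩
        sumF F (conjugate x) n                          ≡⟨ cong (sumF F (conjugate x)) (ℕₚ.suc-pred n) ⟨
        sumF F (conjugate x) (suc (ℕ.pred n))           ≈⟨ +-congʳ (eval-tracePolynomial (ℕ.pred n) x) ⟨
        eval p x + x ^ 2 ℕ.^ e                          ∎

    2^[m∸s]*2^s≡q : 2 ℕ.^ (m ∸ s) ℕ.* 2 ℕ.^ s ≡ q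
    2^[m∸s]*2^s≡q = ≡.trans (≡.sym (ℕₚ.^-distribˡ-+-* 2 (m ∸ s) s)) (cong (2 ℕ.^_) (ℕₚ.m∸n+n≡m (∣⇒≤ s∣m)))

    Image-℘⊆Tr≈0 : ∀ {j} → s ∣ j → AdditiveMap.Image (℘ j) (℘-cong j) (℘-homo-+ j) ⊆ (λ t → Tr F s t ≈ 0#)
    Image-℘⊆Tr≈0 s∣j (w , ℘w≈t) = trans (Tr-cong (sym ℘w≈t)) (Tr∘℘≈0 s∣j w)

    module ℘ₛ = AdditiveMap (℘ s) (℘-cong s) (℘-homo-+ s)

    -- Both factors of |image| * |kernel| = 2 ^ (m ∸ s) * 2 ^ s are bounded by the corresponding ones.
    kernel-size-℘ₛ≡2^s : ℘ₛ.kernel-size ≡ 2 ℕ.^ s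
    kernel-size-℘ₛ≡2^s = m≤o∧n≤p∧m*n≡o*p⇒n≡p {o = 2 ℕ.^ (m ∸ s)} {{ℕ.>-nonZero (ℕₚ.m^n>0 2 (m ∸ s))}}
      (ℕₚ.≤-trans (count-mono ℘ₛ.image? (λ t → Tr F s t ≟ 0#) (Image-℘⊆Tr≈0 ∣-refl)) count-Tr≈0≤)
      (count-℘≈0≤ s)
      (≡.trans ℘ₛ.image-size*kernel-size≡q (≡.sym 2^[m∸s]*2^s≡q))

  module ℘-Equation (k : ℕ) .{{_ : NonZero k}} .{{_ : NonZero m}} where

    s : ℕ
    s = gcd k m

    instance
      s≢0 : NonZero s
      s≢0 = gcd-nonZero k m

    open RelativeTrace s (gcd[m,n]∣n k m)

    module ℘ₖ = AdditiveMap (℘ k) (℘-cong k) (℘-homo-+ k)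

    kernel-size-℘ₖ≡2^s : ℘ₖ.kernel-size ≡ 2 ℕ.^ s
    kernel-size-℘ₖ≡2^s = ≡.trans (count-cong (λ w → ℘ k w ≟ 0#) (λ w → ℘ s w ≟ 0#) (k⇒s , s⇒k)) kernel-size-℘ₛ≡2^s
      where
      k⇒s : ∀ {w} → ℘ k w ≈ 0# → ℘ s w ≈ 0#
      k⇒s {w} ℘ₖw≈0 = proj₂ (℘≈0⇔Fixed s w) (Fixed-gcd k m (proj₁ (℘≈0⇔Fixed k w) ℘ₖw≈0) (Fixed-m w))
      s⇒k : ∀ {w} → ℘ s w ≈ 0# → ℘ k w ≈ 0#
      s⇒k {w} ℘ₛw≈0 = proj₂ (℘≈0⇔Fixed k w) (Fixed-∣ (gcd[m,n]∣m k m) (proj₁ (℘≈0⇔Fixed s w) ℘ₛw≈0))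

    image-size-℘ₖ≡2^[m∸s] : ℘ₖ.image-size ≡ 2 ℕ.^ (m ∸ s)
    image-size-℘ₖ≡2^[m∸s] = ℕₚ.*-cancelʳ-≡ _ _ (2 ℕ.^ s) {{ℕ.>-nonZero (ℕₚ.m^n>0 2 s)}}
      (≡.trans (≡.subst (λ c → ℘ₖ.image-size ℕ.* c ≡ q) kernel-size-℘ₖ≡2^s ℘ₖ.image-size*kernel-size≡q)
               (≡.sym 2^[m∸s]*2^s≡q))

    Tr≈0⇒Image-℘ₖ : (λ t → Tr F s t ≈ 0#) ⊆ ℘ₖ.Image
    Tr≈0⇒Image-℘ₖ = count-≥⇒⊇ ℘ₖ.image? (λ t → Tr F s t ≟ 0#)
      ℘ₖ.Image-resp (λ t≈t′ Trt≈0 → trans (Tr-cong (sym t≈t′)) Trt≈0) (Image-℘⊆Tr≈0 (gcd[m,n]∣m k m))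
      (ℕₚ.≤-trans count-Tr≈0≤ (ℕₚ.≤-reflexive (≡.sym image-size-℘ₖ≡2^[m∸s])))

    count-℘ₖ≈b-Tr≈0 : ∀ b → Tr F s b ≈ 0# → count F (λ w → ℘ k w ≟ b) ≡ 2 ℕ.^ s
    count-℘ₖ≈b-Tr≈0 b Trb≈0 = ≡.trans (℘ₖ.count-fibre-image (Tr≈0⇒Image-℘ₖ Trb≈0)) kernel-size-℘ₖ≡2^s

    count-℘ₖ≈b-Tr≉0 : ∀ b → Tr F s b ≉ 0# → count F (λ w → ℘ k w ≟ b) ≡ 0
    count-℘ₖ≈b-Tr≉0 b Trb≉0 = ℘ₖ.count-fibre-∉image (Trb≉0 ∘ Image-℘⊆Tr≈0 (gcd[m,n]∣m k m))

  0^n≈0 : ∀ n → .{{NonZero n}} → 0# ^ n ≈ 0#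
  0^n≈0 (suc n) = zeroˡ _

  module Equation (k : ℕ) .{{_ : NonZero k}} (a : Carrier) (a≉0 : a ≉ 0#) where

    e : ℕ
    e = 2 ℕ.^ k ∸ 1

    instance
      e≢0 : NonZero e
      e≢0 = ℕ.>-nonZero (ℕₚ.∸-monoˡ-≤ 1 (ℕₚ.^-monoʳ-≤ 2 (ℕ.>-nonZero⁻¹ k)))

    E : Carrier → Carrier
    E x = pow F x (2 ℕ.^ k) + pow F x e

    x^2^k≈x*x^e : ∀ x → x ^ 2 ℕ.^ k ≈ x * x ^ e
    x^2^k≈x*x^e x = ^-congʳ x (≡.sym (≡.trans (ℕₚ.+-comm 1 e) (ℕₚ.m∸n+n≡m (ℕₚ.m^n>0 2 k))))

    E≈x*x^e+x^e : ∀ x → E x ≈ x * x ^ e + x ^ e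
    E≈x*x^e+x^e x = +-cong (trans (pow≈^ x (2 ℕ.^ k)) (x^2^k≈x*x^e x)) (pow≈^ x e)

    E-cong : E Preserves _≈_ ⟶ _≈_
    E-cong x≈y = +-cong (pow-cong (2 ℕ.^ k) x≈y) (pow-cong e x≈y)

    E[0]≈0 : E 0# ≈ 0#
    E[0]≈0 = trans (E≈x*x^e+x^e 0#) (trans (+-cong (zeroˡ _) (0^n≈0 e)) (+-identityʳ 0#))

    E[x]*φₖu≈1+u : ∀ {x u} → x * u ≈ 1# → E x * φ k u ≈ 1# + u
    E[x]*φₖu≈1+u {x} {u} xu≈1 = begin
      E x * φ k u                                   ≈⟨ *-congʳ (+-congʳ (pow≈^ x (2 ℕ.^ k))) ⟩
      (φ k x + pow F x e) * φ k u                   ≈⟨ distribʳ _ _ _ ⟩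
      φ k x * φ k u + pow F x e * φ k u             ≈⟨ +-cong φₖx*φₖu≈1 x^e*φₖu≈u ⟩
      1# + u                                        ∎
      where
      x^n*u^n≈1 : ∀ n → x ^ n * u ^ n ≈ 1#
      x^n*u^n≈1 n = trans (sym (^-distrib-* x u n)) (trans (^-congˡ n xu≈1) (1^n≈1 n))
      φₖx*φₖu≈1 : φ k x * φ k u ≈ 1#
      φₖx*φₖu≈1 = x^n*u^n≈1 (2 ℕ.^ k)
      x^e*φₖu≈u : pow F x e * φ k u ≈ u
      x^e*φₖu≈u = begin
        pow F x e * φ k u        ≈⟨ *-cong (pow≈^ x e) (x^2^k≈x*x^e u) ⟩
        x ^ e * (u * u ^ e)      ≈⟨ *-x∙yz≈y∙xz _ _ _ ⟩
        u * (x ^ e * u ^ e)      ≈⟨ *-congˡ (x^n*u^n≈1 e) ⟩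
        u * 1#                   ≈⟨ *-identityʳ u ⟩
        u                        ∎

    Lₐ : Carrier → Carrier
    Lₐ u = a * φ k u + u

    Lₐ-cong : Lₐ Preserves _≈_ ⟶ _≈_
    Lₐ-cong u≈v = +-cong (*-congˡ (φ-cong k u≈v)) u≈v

    Lₐ-homo-+ : ∀ u v → Lₐ (u + v) ≈ Lₐ u + Lₐ v
    Lₐ-homo-+ u v = trans (+-congʳ (trans (*-congˡ (φ-homo-+ k u v)) (distribˡ a _ _))) (+-interchange _ _ u v)

    module Lₐ = AdditiveMap Lₐ Lₐ-cong Lₐ-homo-+

    count-E≈a≡count-Lₐ≈1 : count F (λ x → E x ≟ a) ≡ count F (λ u → Lₐ u ≟ 1#)
    count-E≈a≡count-Lₐ≈1 = count-permute (λ x → E x ≟ a) (λ u → Lₐ u ≟ 1#) inversion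
      (λ u≈v Lₐu≈1 → trans (Lₐ-cong (sym u≈v)) Lₐu≈1) (E≈a⇒Lₐ[x⁻¹]≈1 , Lₐ[x⁻¹]≈1⇒E≈a)
      where
      E≈a⇒Lₐ[x⁻¹]≈1 : ∀ {x} → E x ≈ a → Lₐ (x ⁻¹) ≈ 1#
      E≈a⇒Lₐ[x⁻¹]≈1 {x} Ex≈a with x≈0⊎x≉0 x
      ... | inj₁ x≈0 = ⊥-elim (a≉0 (trans (sym Ex≈a) (trans (E-cong x≈0) E[0]≈0)))
      ... | inj₂ x≉0 = begin
        a * φ k (x ⁻¹) + x ⁻¹       ≈⟨ +-congʳ (*-congʳ Ex≈a) ⟨
        E x * φ k (x ⁻¹) + x ⁻¹     ≈⟨ +-congʳ (E[x]*φₖu≈1+u (x*x⁻¹≈1 x≉0)) ⟩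
        (1# + x ⁻¹) + x ⁻¹          ≈⟨ +-assoc 1# _ _ ⟩
        1# + (x ⁻¹ + x ⁻¹)          ≈⟨ +-congˡ (x+x≈0 (x ⁻¹)) ⟩
        1# + 0#                     ≈⟨ +-identityʳ 1# ⟩
        1#                          ∎
      Lₐ[x⁻¹]≈1⇒E≈a : ∀ {x} → Lₐ (x ⁻¹) ≈ 1# → E x ≈ a
      Lₐ[x⁻¹]≈1⇒E≈a {x} Lₐx⁻¹≈1 with x≈0⊎x≉0 x
      ... | inj₁ x≈0 = ⊥-elim (1≉0 (trans (sym Lₐx⁻¹≈1) (trans (Lₐ-cong (x≈0⇒x⁻¹≈0 x≈0)) Lₐ.L-0)))
      ... | inj₂ x≉0 = *-cancelʳ (x≉0⇒x^n≉0 (2 ℕ.^ k) (x≉0⇒x⁻¹≉0 x≉0)) (begin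
        E x * φ k (x ⁻¹)            ≈⟨ E[x]*φₖu≈1+u (x*x⁻¹≈1 x≉0) ⟩
        1# + x ⁻¹                   ≈⟨ +-comm 1# _ ⟩
        x ⁻¹ + 1#                   ≈⟨ x+y≈z⇒y≈x+z (trans (+-comm _ _) Lₐx⁻¹≈1) ⟨
        a * φ k (x ⁻¹)              ∎)

    -- Without a (2 ^ k ∸ 1)-th root of a, Lₐ is injective: Lₐ u ≈ 0 with u ≉ 0 would give a ≈ (u ⁻¹) ^ e.
    count-Lₐ≈1-no-root : ¬ (∃ λ b → a ≈ pow F b e) → count F (λ u → Lₐ u ≟ 1#) ≡ 1
    count-Lₐ≈1-no-root no-root =
      ≡.trans (Lₐ.count-fibre-image (Lₐ.kernel-size≡1⇒surjective kernel-size≡1 1#)) kernel-size≡1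
      where
      kernel-trivial : ∀ {u} → Lₐ u ≈ 0# → u ≈ 0#
      kernel-trivial {u} Lₐu≈0 with x≈0⊎x≉0 u
      ... | inj₁ u≈0 = u≈0
      ... | inj₂ u≉0 = ⊥-elim (no-root (u ⁻¹ , a≈[u⁻¹]^e))
        where
        a*u^e≈1 : a * u ^ e ≈ 1#
        a*u^e≈1 = *-cancelˡ u≉0 (begin
          u * (a * u ^ e)   ≈⟨ *-x∙yz≈y∙xz u a _ ⟩
          a * (u * u ^ e)   ≈⟨ *-congˡ (x^2^k≈x*x^e u) ⟨
          a * φ k u         ≈⟨ x+y≈0⇒x≈y Lₐu≈0 ⟩
          u                 ≈⟨ *-identityʳ u ⟨
          u * 1#            ∎)
        a≈[u⁻¹]^e : a ≈ pow F (u ⁻¹) e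
        a≈[u⁻¹]^e = begin
          a                         ≈⟨ *-identityʳ a ⟨
          a * 1#                    ≈⟨ *-congˡ (trans (^-congˡ e (x*x⁻¹≈1 u≉0)) (1^n≈1 e)) ⟨
          a * (u * u ⁻¹) ^ e        ≈⟨ *-congˡ (^-distrib-* u (u ⁻¹) e) ⟩
          a * (u ^ e * u ⁻¹ ^ e)    ≈⟨ *-assoc a _ _ ⟨
          (a * u ^ e) * u ⁻¹ ^ e    ≈⟨ *-congʳ a*u^e≈1 ⟩
          1# * u ⁻¹ ^ e             ≈⟨ *-identityˡ _ ⟩
          u ⁻¹ ^ e                  ≈⟨ pow≈^ (u ⁻¹) e ⟨
          pow F (u ⁻¹) e            ∎
      kernel-size≡1 : Lₐ.kernel-size ≡ 1
      kernel-size≡1 = ≡.trans (count-cong (λ u → Lₐ u ≟ 0#) (_≟ 0#) (kernel-trivial , λ u≈0 → trans (Lₐ-cong u≈0) Lₐ.L-0))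
                              (count-≈ 0#)

    count-Lₐ≈1≡count-℘ₖ≈b : ∀ b → a ≈ pow F b e → count F (λ u → Lₐ u ≟ 1#) ≡ count F (λ w → ℘ k w ≟ b)
    count-Lₐ≈1≡count-℘ₖ≈b b a≈bᵉ = count-permute (λ u → Lₐ u ≟ 1#) (λ w → ℘ k w ≟ b) (scaling b b≉0)
      (λ w≈w′ ℘w≈b → trans (℘-cong k (sym w≈w′)) ℘w≈b)
      ( (λ {u} Lₐu≈1 → trans (℘ₖ[b*u]≈b*Lₐu u) (trans (*-congˡ Lₐu≈1) (*-identityʳ b)))
      , (λ {u} ℘ₖ[bu]≈b → *-cancelˡ b≉0 (trans (sym (℘ₖ[b*u]≈b*Lₐu u)) (trans ℘ₖ[bu]≈b (sym (*-identityʳ b))))))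
      where
      b≉0 : b ≉ 0#
      b≉0 b≈0 = a≉0 (trans a≈bᵉ (trans (pow-cong e b≈0) (trans (pow≈^ 0# e) (0^n≈0 e))))
      ℘ₖ[b*u]≈b*Lₐu : ∀ u → ℘ k (b * u) ≈ b * Lₐ u
      ℘ₖ[b*u]≈b*Lₐu u = begin
        φ k (b * u) + b * u          ≈⟨ +-congʳ (φ-homo-* k b u) ⟩
        φ k b * φ k u + b * u        ≈⟨ +-congʳ (*-congʳ (trans (x^2^k≈x*x^e b) (*-congˡ (trans (sym (pow≈^ b e)) (sym a≈bᵉ))))) ⟩
        (b * a) * φ k u + b * u      ≈⟨ +-congʳ (*-assoc b a _) ⟩
        b * (a * φ k u) + b * u      ≈⟨ distribˡ b _ _ ⟨
        b * Lₐ u                     ∎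

open import Data.Nat using (_^_)

theorem6 : (m : ℕ) → m > 2 → (F : FiniteField m) → (k : ℕ) → .{{_ : NonZero k}} →
  let open FiniteField F
      s = gcd k m
      N : Carrier → ℕ
      N a = count F (λ x → (pow F x (2 ^ k) + pow F x ((2 ^ k) ∸ 1)) ≟ a)
  in (a : Carrier) → ¬ (a ≈ 0#) →
       ((¬ (∃ λ b → a ≈ pow F b ((2 ^ k) ∸ 1))) → N a ≡ 1)
     × (∀ b → a ≈ pow F b ((2 ^ k) ∸ 1) → Tr F s {{gcd-nonZero k m}} b ≈ 0# → N a ≡ 2 ^ s)
     × (∀ b → a ≈ pow F b ((2 ^ k) ∸ 1) → ¬ (Tr F s {{gcd-nonZero k m}} b ≈ 0#) → N a ≡ 0)
theorem6 m m>2 F k a a≉0 =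
    (λ no-root → ≡.trans count-E≈a≡count-Lₐ≈1 (count-Lₐ≈1-no-root no-root))
  , (λ b a≈bᵉ Trb≈0 → ≡.trans count-E≈a≡count-Lₐ≈1
                        (≡.trans (count-Lₐ≈1≡count-℘ₖ≈b b a≈bᵉ) (count-℘ₖ≈b-Tr≈0 b Trb≈0)))
  , (λ b a≈bᵉ Trb≉0 → ≡.trans count-E≈a≡count-Lₐ≈1
                        (≡.trans (count-Lₐ≈1≡count-℘ₖ≈b b a≈bᵉ) (count-℘ₖ≈b-Tr≉0 b Trb≉0)))
  where
  instance
    m≢0 : NonZero m
    m≢0 = ℕ.>-nonZero (ℕₚ.<-trans (s≤s z≤n) m>2)
  open FiniteFieldTheory F
  open Equation k a a≉0
  open ℘-Equation k
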